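{- Let $c \geq 0$ be an integer and let $q, r, s$ be pairwise distinct odd primes. Then each of the following numbers is pristine: (i) $2^c$; (ii) $2^c q$, provided $q = c+2$; (iii) $2^c q r$, provided $q r = c^2 + 6c + 6$; (iv) $2^c q^2$, provided $q^2 = (c^2 + 7c + 8)/2$; (v) $2^c q r s$, provided $q r s = c^3 + 12c^2 + 36c + 26$; (vi) $2^c q^2 r$, provided $q^2 r = (c^3 + 13c^2 + 42c + 32)/2$.
   Context: For positive integers, write $m \lfloor n$ to mean that $m$ is a proper divisor of $n$. The number of recursive divisors is defined by $a(1)=1$ and $a(n) = 1 + \sum_{m \lfloor n} a(m)$ for $n>1$. A positive integer $n$ is pristine if $a(n) = n$. -}

module Defs where

open import Data.Nat using (ℕ; zero; suc; _+_; _*_; _∸_; _<_)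
open import Data.Nat.Divisibility using (_∣_; _∣?_)
open import Data.List using (List; filter; map; upTo)
open import Data.Nat.ListAction using (sum)
open import Relation.Binary.PropositionalEquality using (_≡_)

properDivisors : ℕ → List ℕ
properDivisors n = filter (λ m → m ∣? n) (map suc (upTo (n ∸ 1)))

-- fuel-indexed recursion: rdFuel k n computes a(n) whenever n ≤ k
rdFuel : ℕ → ℕ → ℕ
rdFuel zero    n = 0
rdFuel (suc k) n = 1 + sum (map (rdFuel k) (properDivisors n))

-- number of recursive divisors: a(1) = 1, a(n) = 1 + Σ_{m proper divisor of n} a(m)
a : ℕ → ℕ
a n = rdFuel n n

Pristine : ℕ → Set
Pristine n = a n ≡ n

{-# OPTIONS --safe #-}
module Submission where

-- Adding a(n) to a(n) = 1 + Σ a(d), d over the proper divisors of n, gives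
-- 2 a(n) = 1 + Σ_{d ∣ n} a(d).  For odd x the divisors of 2^(c+1) x are those of 2^c x
-- together with the 2^(c+1) d, d ∣ x, so a(2^(c+1) x) = 2 a(2^c x) + Σ a(2^(c+1) d), d over
-- the proper divisors of x.  Hence if every proper divisor d of x has
-- 2 a(2^c d) = 2^c P_d(c), then 2 a(2^c x) = 2^c P_x(c) where
-- P_x(0) = 2 + Σ_d P_d(0) and P_x(c+1) = P_x(c) + Σ_d P_d(c+1).  Climbing the divisor
-- lattices of 1, q, qr, q², qrs, q²r yields explicit polynomials P_x, and each hypothesis
-- of the theorem says exactly that P_x(c) = 2x, i.e. a(2^c x) = 2^c x.

open import Defs
open import Data.Nat using (ℕ; zero; suc; _+_; _*_; _^_; _≤_; _<_; z≤n; s≤s; s≤s⁻¹; NonZero; >-nonZero⁻¹)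
open import Data.Nat.Properties
open import Data.Nat.Solver using (module +-*-Solver)
open import Data.Nat.Divisibility
open import Data.List using (List; []; _∷_; _++_; [_]; filter; map; foldr; upTo)
open import Data.List.Relation.Binary.Pointwise using (Pointwise; []; _∷_)
open import Data.List.Properties using (map-cong; map-cong-local; map-++; map-∘; filter-++; filter-accept; upTo-∷ʳ)
open import Data.List.Membership.Propositional using (_∈_)
open import Data.List.Membership.Propositional.Properties
  using (∈-filter⁻; ∈-filter⁺; ∈-map⁻; ∈-map⁺; ∈-upTo⁻; ∈-upTo⁺; ∈-++⁺ˡ; ∈-++⁺ʳ; ∈-++⁻)
open import Data.List.Membership.Propositional.Properties.WithK using (unique∧set⇒bag)
open import Data.List.Relation.Unary.Unique.Propositional using (Unique)
import Data.List.Relation.Unary.Unique.Propositional.Properties as Unique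
open import Data.List.Relation.Binary.BagAndSetEquality using (_∼[_]_; set; ∼bag⇒↭)
import Data.List.Relation.Binary.Permutation.Propositional.Properties as Perm
import Data.List.Relation.Unary.All as All
open import Data.Nat.ListAction using (sum)
open import Data.Nat.ListAction.Properties using (sum-++; sum-↭)
open import Data.Nat.Primality using (Prime; prime⇒irreducible; prime⇒nonZero; ¬prime[1]; prime[2]; euclidsLemma)
open import Data.Nat.Coprimality using (Coprime; coprime-divisor)
open import Data.Product using (_×_; _,_; proj₁; proj₂; ∃₂)
open import Data.Sum using (inj₁; inj₂)
open import Data.Empty using (⊥-elim)
open import Relation.Nullary using (¬_; yes; no)
open import Function.Bundles using (mk⇔)
open import Algebra.Properties.CommutativeSemigroup *-commutativeSemigroup using (x∙yz≈y∙xz; x∙yz≈xz∙y; xy∙z≈x∙zy)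
open import Relation.Binary.PropositionalEquality hiding ([_])
open import Function using (_∘′_; case_of_)

properDivisorSum : (ℕ → ℕ) → ℕ → ℕ
properDivisorSum f n = sum (map f (properDivisors n))

properDivisorSum-cong : ∀ {f g} → (∀ d → f d ≡ g d) → ∀ n → properDivisorSum f n ≡ properDivisorSum g n
properDivisorSum-cong f≗g n = cong sum (map-cong f≗g (properDivisors n))

∈-properDivisors⁻ : ∀ {n d} → d ∈ properDivisors n → 0 < d × d < n
∈-properDivisors⁻ {suc n} d∈ with ∈-map⁻ suc (proj₁ (∈-filter⁻ (_∣? suc n) {xs = map suc (upTo n)} d∈))
... | e , e∈ , refl = s≤s z≤n , s≤s (∈-upTo⁻ e∈)

rdFuel-stable : ∀ {k j m} → 0 < m → m ≤ k → m ≤ j → rdFuel k m ≡ rdFuel j m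
rdFuel-stable {zero}  {m = suc _} _ () _
rdFuel-stable {suc _} {zero} {suc _} _ _ ()
rdFuel-stable {suc k} {suc j} {m} _ m≤k m≤j =
  cong (λ ds → 1 + sum ds) (map-cong-local (All.tabulate λ d∈ →
    let d>0 , d<m = ∈-properDivisors⁻ {m} d∈
    in rdFuel-stable d>0 (s≤s⁻¹ (≤-trans d<m m≤k)) (s≤s⁻¹ (≤-trans d<m m≤j))))

a-unfold : ∀ {n} → 0 < n → a n ≡ 1 + properDivisorSum a n
a-unfold {suc n} _ = cong (λ ds → 1 + sum ds) (map-cong-local {xs = properDivisors (suc n)} (All.tabulate λ d∈ →
  let d>0 , d<n = ∈-properDivisors⁻ {suc n} d∈ in rdFuel-stable d>0 (s≤s⁻¹ d<n) ≤-refl))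

divisors : ℕ → List ℕ
divisors n = filter (_∣? n) (map suc (upTo n))

divisorSum : (ℕ → ℕ) → ℕ → ℕ
divisorSum f n = sum (map f (divisors n))

divisors-suc : ∀ n → divisors (suc n) ≡ properDivisors (suc n) ++ [ suc n ]
divisors-suc n = begin
  filter (_∣? suc n) (map suc (upTo (suc n)))
    ≡⟨ cong (λ xs → filter (_∣? suc n) (map suc xs)) (sym (upTo-∷ʳ n)) ⟩
  filter (_∣? suc n) (map suc (upTo n ++ [ n ]))
    ≡⟨ cong (filter (_∣? suc n)) (map-++ suc (upTo n) [ n ]) ⟩
  filter (_∣? suc n) (map suc (upTo n) ++ [ suc n ])
    ≡⟨ filter-++ (_∣? suc n) (map suc (upTo n)) [ suc n ] ⟩
  properDivisors (suc n) ++ filter (_∣? suc n) [ suc n ]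
    ≡⟨ cong (properDivisors (suc n) ++_) (filter-accept (_∣? suc n) {xs = []} ∣-refl) ⟩
  properDivisors (suc n) ++ [ suc n ] ∎
  where open ≡-Reasoning

divisorSum≡properDivisorSum+ : ∀ f {n} → 0 < n → divisorSum f n ≡ properDivisorSum f n + f n
divisorSum≡properDivisorSum+ f {suc n} _ = begin
  sum (map f (divisors (suc n)))                          ≡⟨ cong (sum ∘′ map f) (divisors-suc n) ⟩
  sum (map f (properDivisors (suc n) ++ [ suc n ]))       ≡⟨ cong sum (map-++ f (properDivisors (suc n)) [ suc n ]) ⟩
  sum (map f (properDivisors (suc n)) ++ [ f (suc n) ])   ≡⟨ sum-++ (map f (properDivisors (suc n))) [ f (suc n) ] ⟩
  properDivisorSum f (suc n) + (f (suc n) + 0)            ≡⟨ cong (properDivisorSum f (suc n) +_) (+-identityʳ (f (suc n))) ⟩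
  properDivisorSum f (suc n) + f (suc n) ∎
  where open ≡-Reasoning

∈-divisors⁻ : ∀ n {d} → d ∈ divisors n → d ∣ n
∈-divisors⁻ n d∈ = proj₂ (∈-filter⁻ (_∣? n) {xs = map suc (upTo n)} d∈)

∈-divisors⁺ : ∀ {n d} → 0 < n → d ∣ n → d ∈ divisors n
∈-divisors⁺ {suc n} {zero}  _ 0∣n with () ← 0∣⇒≡0 0∣n
∈-divisors⁺ {suc n} {suc d} _ d∣n = ∈-filter⁺ (_∣? suc n) (∈-map⁺ suc (∈-upTo⁺ (∣⇒≤ d∣n))) d∣n

divisors-unique : ∀ n → Unique (divisors n)
divisors-unique n = Unique.filter⁺ (_∣? n) (Unique.map⁺ suc-injective (Unique.upTo⁺ n))

sum-map-unique-set : ∀ f {xs ys : List ℕ} → Unique xs → Unique ys → xs ∼[ set ] ys →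
                     sum (map f xs) ≡ sum (map f ys)
sum-map-unique-set f xs! ys! xs≈ys = sum-↭ (Perm.map⁺ f (∼bag⇒↭ (unique∧set⇒bag xs! ys! xs≈ys)))

prime>0 : ∀ {p} → Prime p → 0 < p
prime>0 {p} p-prime = >-nonZero⁻¹ p {{prime⇒nonZero p-prime}}

prime∤1 : ∀ {p} → Prime p → ¬ p ∣ 1
prime∤1 p-prime p∣1 = ¬prime[1] (subst Prime (∣1⇒≡1 p∣1) p-prime)

prime∤prime : ∀ {p q} → Prime p → Prime q → p ≢ q → ¬ p ∣ q
prime∤prime p-prime q-prime p≢q p∣q with prime⇒irreducible q-prime p∣q
... | inj₁ refl = ¬prime[1] p-prime
... | inj₂ p≡q  = p≢q p≡q

prime∤* : ∀ {p m n} → Prime p → ¬ p ∣ m → ¬ p ∣ n → ¬ p ∣ m * n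
prime∤* {m = m} {n} p-prime p∤m p∤n p∣m*n with euclidsLemma m n p-prime p∣m*n
... | inj₁ p∣m = p∤m p∣m
... | inj₂ p∣n = p∤n p∣n

prime∤^ : ∀ {p m} → Prime p → ¬ p ∣ m → ∀ n → ¬ p ∣ m ^ n
prime∤^ p-prime p∤m zero    = prime∤1 p-prime
prime∤^ p-prime p∤m (suc n) = prime∤* p-prime p∤m (prime∤^ p-prime p∤m n)

2∤odd-prime : ∀ {p} → Prime p → p ≢ 2 → ¬ 2 ∣ p
2∤odd-prime p-prime p≢2 = prime∤prime prime[2] p-prime (p≢2 ∘′ sym)

prime∤⇒coprime : ∀ {p n} → Prime p → ¬ p ∣ n → Coprime n p
prime∤⇒coprime p-prime p∤n (i∣n , i∣p) with prime⇒irreducible p-prime i∣p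
... | inj₁ i≡1    = i≡1
... | inj₂ refl   = ⊥-elim (p∤n i∣n)

^-monoʳ-∣ : ∀ p {j k} → j ≤ k → p ^ j ∣ p ^ k
^-monoʳ-∣ p {zero}  {k}     _         = 1∣ (p ^ k)
^-monoʳ-∣ p {suc j} {suc k} (s≤s j≤k) = *-monoʳ-∣ p (^-monoʳ-∣ p j≤k)

∣*prime^⇒ : ∀ {p x d} → Prime p → ∀ m → d ∣ x * p ^ m → ∃₂ λ e j → e ∣ x × j ≤ m × d ≡ e * p ^ j
∣*prime^⇒ {x = x} {d} _ zero d∣x*1 = d , 0 , subst (d ∣_) (*-identityʳ x) d∣x*1 , z≤n , sym (*-identityʳ d)
∣*prime^⇒ {p} {x} {d} p-prime (suc m) d∣x*p^1+m with p ∣? d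
... | yes (divides w refl)
  with ∣*prime^⇒ {x = x} {w} p-prime m
         (*-cancelʳ-∣ p {{prime⇒nonZero p-prime}} (subst (w * p ∣_) (x∙yz≈xz∙y x p (p ^ m)) d∣x*p^1+m))
...   | e , j , e∣x , j≤m , refl = e , suc j , e∣x , s≤s j≤m , xy∙z≈x∙zy e (p ^ j) p
∣*prime^⇒ {p} {x} {d} p-prime (suc m) d∣x*p^1+m | no p∤d
  with ∣*prime^⇒ p-prime m (coprime-divisor (prime∤⇒coprime p-prime p∤d) (subst (d ∣_) (x∙yz≈y∙xz x p (p ^ m)) d∣x*p^1+m))
... | e , j , e∣x , j≤m , d≡e*p^j = e , j , e∣x , m≤n⇒m≤1+n j≤m , d≡e*p^j

-- ds is the multiset of proper divisors of x: sums against every g determine it.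
record _HasProperDivisors_ (x : ℕ) (ds : List ℕ) : Set where
  constructor properDivisorSum≡
  field sum-properDivisors : ∀ g → properDivisorSum g x ≡ sum (map g ds)
open _HasProperDivisors_

hasProperDivisors-1 : 1 HasProperDivisors []
hasProperDivisors-1 = properDivisorSum≡ λ _ → refl

module _ {p x : ℕ} (p-prime : Prime p) (p∤x : ¬ p ∣ x) (x>0 : 0 < x) (k : ℕ) where

  private
    instance
      p≢0 : NonZero p
      p≢0 = prime⇒nonZero p-prime

    x*p^>0 : ∀ j → 0 < x * p ^ j
    x*p^>0 j = *-mono-≤ x>0 (m^n>0 p j)

    lower upper : List ℕ
    lower = divisors (x * p ^ k)
    upper = map (_* p ^ suc k) (divisors x)

  divisors-*-prime^suc : divisors (x * p ^ suc k) ∼[ set ] lower ++ upper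
  divisors-*-prime^suc = mk⇔ to from
    where
    to : ∀ {d} → d ∈ divisors (x * p ^ suc k) → d ∈ lower ++ upper
    to d∈ with ∣*prime^⇒ {x = x} p-prime (suc k) (∈-divisors⁻ (x * p ^ suc k) d∈)
    ... | e , j , e∣x , j≤1+k , refl with m≤n⇒m<n∨m≡n j≤1+k
    ...   | inj₁ (s≤s j≤k) = ∈-++⁺ˡ (∈-divisors⁺ (x*p^>0 k) (*-pres-∣ e∣x (^-monoʳ-∣ p j≤k)))
    ...   | inj₂ refl      = ∈-++⁺ʳ lower (∈-map⁺ (_* p ^ suc k) (∈-divisors⁺ x>0 e∣x))
    from : ∀ {d} → d ∈ lower ++ upper → d ∈ divisors (x * p ^ suc k)
    from d∈ with ∈-++⁻ lower d∈
    ... | inj₁ d∈lower = ∈-divisors⁺ (x*p^>0 (suc k)) (∣-trans (∈-divisors⁻ (x * p ^ k) d∈lower) (*-monoʳ-∣ x (n∣m*n p)))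
    ... | inj₂ d∈upper with ∈-map⁻ (_* p ^ suc k) d∈upper
    ...   | e , e∈ , refl = ∈-divisors⁺ (x*p^>0 (suc k)) (*-monoˡ-∣ (p ^ suc k) (∈-divisors⁻ x e∈))

  lower++upper-unique : Unique (lower ++ upper)
  lower++upper-unique = Unique.++⁺ (divisors-unique (x * p ^ k))
    (Unique.map⁺ (*-cancelʳ-≡ _ _ (p ^ suc k) {{m^n≢0 p (suc k)}}) (divisors-unique x))
    λ (d∈lower , d∈upper) → case ∈-map⁻ (_* p ^ suc k) d∈upper of λ where
      (e , _ , refl) → p∤x (*-cancelʳ-∣ (p ^ k) {{m^n≢0 p k}} (∣-trans (n∣m*n e) (∈-divisors⁻ (x * p ^ k) d∈lower)))

  divisorSum-*-prime^suc : ∀ f → divisorSum f (x * p ^ suc k) ≡ divisorSum f (x * p ^ k) + divisorSum (λ d → f (d * p ^ suc k)) x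
  divisorSum-*-prime^suc f = begin
    divisorSum f (x * p ^ suc k)
      ≡⟨ sum-map-unique-set f (divisors-unique (x * p ^ suc k)) lower++upper-unique divisors-*-prime^suc ⟩
    sum (map f (lower ++ upper))               ≡⟨ cong sum (map-++ f lower upper) ⟩
    sum (map f lower ++ map f upper)           ≡⟨ sum-++ (map f lower) (map f upper) ⟩
    divisorSum f (x * p ^ k) + sum (map f upper) ≡⟨ cong (λ ds → divisorSum f (x * p ^ k) + sum ds) (map-∘ (divisors x)) ⟨
    divisorSum f (x * p ^ k) + divisorSum (λ d → f (d * p ^ suc k)) x ∎
    where open ≡-Reasoning

  properDivisorSum-*-prime^suc : ∀ g → properDivisorSum g (x * p ^ suc k)
                               ≡ divisorSum g (x * p ^ k) + properDivisorSum (λ d → g (d * p ^ suc k)) x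
  properDivisorSum-*-prime^suc g = +-cancelʳ-≡ (g (x * p ^ suc k)) _ _ (begin
    properDivisorSum g (x * p ^ suc k) + g (x * p ^ suc k)    ≡⟨ divisorSum≡properDivisorSum+ g (x*p^>0 (suc k)) ⟨
    divisorSum g (x * p ^ suc k)                               ≡⟨ divisorSum-*-prime^suc g ⟩
    divisorSum g (x * p ^ k) + divisorSum g′ x                 ≡⟨ cong (divisorSum g (x * p ^ k) +_) (divisorSum≡properDivisorSum+ g′ x>0) ⟩
    divisorSum g (x * p ^ k) + (properDivisorSum g′ x + g′ x)  ≡⟨ +-assoc (divisorSum g (x * p ^ k)) _ _ ⟨
    divisorSum g (x * p ^ k) + properDivisorSum g′ x + g (x * p ^ suc k) ∎)
    where
    open ≡-Reasoning
    g′ : ℕ → ℕ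
    g′ d = g (d * p ^ suc k)

  a-*-prime^suc : a (x * p ^ suc k) ≡ 2 * a (x * p ^ k) + properDivisorSum (λ d → a (d * p ^ suc k)) x
  a-*-prime^suc = begin
    a (x * p ^ suc k)                                          ≡⟨ a-unfold (x*p^>0 (suc k)) ⟩
    1 + properDivisorSum a (x * p ^ suc k)                     ≡⟨ cong (1 +_) (properDivisorSum-*-prime^suc a) ⟩
    1 + (divisorSum a (x * p ^ k) + S)                         ≡⟨ cong (λ t → 1 + (t + S)) (divisorSum≡properDivisorSum+ a (x*p^>0 k)) ⟩
    1 + properDivisorSum a (x * p ^ k) + a (x * p ^ k) + S     ≡⟨ cong (λ t → t + a (x * p ^ k) + S) (a-unfold (x*p^>0 k)) ⟨
    a (x * p ^ k) + a (x * p ^ k) + S                          ≡⟨ cong (λ t → a (x * p ^ k) + t + S) (+-identityʳ (a (x * p ^ k))) ⟨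
    2 * a (x * p ^ k) + S ∎
    where
    open ≡-Reasoning
    S : ℕ
    S = properDivisorSum (λ d → a (d * p ^ suc k)) x

  hasProperDivisors-*-prime^suc : ∀ {es ds} → (x * p ^ k) HasProperDivisors es → x HasProperDivisors ds →
    (x * p ^ suc k) HasProperDivisors (es ++ x * p ^ k ∷ map (_* p ^ suc k) ds)
  hasProperDivisors-*-prime^suc {es} {ds} es-pd ds-pd = properDivisorSum≡ λ g → begin
    properDivisorSum g (x * p ^ suc k)
      ≡⟨ properDivisorSum-*-prime^suc g ⟩
    divisorSum g y + properDivisorSum (λ d → g (d * p ^ suc k)) x
      ≡⟨ cong₂ _+_ (divisorSum≡properDivisorSum+ g (x*p^>0 k)) (sum-properDivisors ds-pd _) ⟩
    properDivisorSum g y + g y + sum (map (λ d → g (d * p ^ suc k)) ds)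
      ≡⟨ cong₂ (λ s t → s + g y + sum t) (sum-properDivisors es-pd g) (map-∘ ds) ⟩
    sum (map g es) + g y + sum (map g (map (_* p ^ suc k) ds))
      ≡⟨ +-assoc (sum (map g es)) (g y) _ ⟩
    sum (map g es) + sum (map g (y ∷ map (_* p ^ suc k) ds))
      ≡⟨ sum-++ (map g es) _ ⟨
    sum (map g es ++ map g (y ∷ map (_* p ^ suc k) ds))
      ≡⟨ cong sum (map-++ g es (y ∷ map (_* p ^ suc k) ds)) ⟨
    sum (map g (es ++ y ∷ map (_* p ^ suc k) ds)) ∎
    where
    open ≡-Reasoning
    y : ℕ
    y = x * p ^ k

hasProperDivisors-*-prime : ∀ {p x ds} → Prime p → ¬ p ∣ x → 0 < x →
  x HasProperDivisors ds → (x * p) HasProperDivisors (ds ++ x ∷ map (_* p) ds)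
hasProperDivisors-*-prime {p} {x} {ds} p-prime p∤x x>0 ds-pd = properDivisorSum≡ λ g → begin
  properDivisorSum g (x * p)
    ≡⟨ cong (λ t → properDivisorSum g (x * t)) (*-identityʳ p) ⟨
  properDivisorSum g (x * p ^ 1)
    ≡⟨ sum-properDivisors (hasProperDivisors-*-prime^suc p-prime p∤x x>0 0 x*1-pd ds-pd) g ⟩
  sum (map g (ds ++ x * 1 ∷ map (_* p ^ 1) ds))
    ≡⟨ cong (λ t → sum (map g (ds ++ t))) (cong₂ _∷_ (*-identityʳ x) (map-cong (λ d → cong (d *_) (*-identityʳ p)) ds)) ⟩
  sum (map g (ds ++ x ∷ map (_* p) ds)) ∎
  where
  open ≡-Reasoning
  x*1-pd : (x * 1) HasProperDivisors ds
  x*1-pd = subst (_HasProperDivisors ds) (sym (*-identityʳ x)) ds-pd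

hasProperDivisors-prime : ∀ {p} → Prime p → p HasProperDivisors (1 ∷ [])
hasProperDivisors-prime {p} p-prime = subst (_HasProperDivisors (1 ∷ [])) (*-identityˡ p)
  (hasProperDivisors-*-prime p-prime (prime∤1 p-prime) (s≤s z≤n) hasProperDivisors-1)

hasProperDivisors-prime*prime : ∀ {p q} → Prime p → Prime q → p ≢ q →
  (p * q) HasProperDivisors (1 ∷ p ∷ q ∷ [])
hasProperDivisors-prime*prime {p} {q} p-prime q-prime p≢q =
  subst (λ t → (p * q) HasProperDivisors (1 ∷ p ∷ t ∷ [])) (*-identityˡ q)
    (hasProperDivisors-*-prime q-prime (prime∤prime q-prime p-prime (p≢q ∘′ sym)) (prime>0 p-prime) (hasProperDivisors-prime p-prime))

hasProperDivisors-prime^2 : ∀ {p} → Prime p → (p ^ 2) HasProperDivisors (1 ∷ p ∷ [])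
hasProperDivisors-prime^2 {p} p-prime =
  subst₂ (λ y t → y HasProperDivisors (1 ∷ t ∷ [])) (*-identityˡ (p ^ 2)) 1*p^1≡p
    (hasProperDivisors-*-prime^suc p-prime (prime∤1 p-prime) (s≤s z≤n) 1
      (subst (_HasProperDivisors (1 ∷ [])) (sym 1*p^1≡p) (hasProperDivisors-prime p-prime)) hasProperDivisors-1)
  where
  1*p^1≡p : 1 * p ^ 1 ≡ p
  1*p^1≡p = trans (*-identityˡ (p ^ 1)) (*-identityʳ p)

hasProperDivisors-prime*prime*prime : ∀ {p q r} → Prime p → Prime q → Prime r → p ≢ q → p ≢ r → q ≢ r →
  (p * q * r) HasProperDivisors (1 ∷ p ∷ q ∷ p * q ∷ r ∷ p * r ∷ q * r ∷ [])
hasProperDivisors-prime*prime*prime {p} {q} {r} p-prime q-prime r-prime p≢q p≢r q≢r =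
  subst (λ t → (p * q * r) HasProperDivisors (1 ∷ p ∷ q ∷ p * q ∷ t ∷ p * r ∷ q * r ∷ [])) (*-identityˡ r)
    (hasProperDivisors-*-prime r-prime r∤p*q (*-mono-≤ (prime>0 p-prime) (prime>0 q-prime))
      (hasProperDivisors-prime*prime p-prime q-prime p≢q))
  where
  r∤p*q : ¬ r ∣ p * q
  r∤p*q = prime∤* r-prime (prime∤prime r-prime p-prime (p≢r ∘′ sym)) (prime∤prime r-prime q-prime (q≢r ∘′ sym))

hasProperDivisors-prime^2*prime : ∀ {p q} → Prime p → Prime q → p ≢ q →
  (p ^ 2 * q) HasProperDivisors (1 ∷ p ∷ p ^ 2 ∷ q ∷ p * q ∷ [])
hasProperDivisors-prime^2*prime {p} {q} p-prime q-prime p≢q =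
  subst (λ t → (p ^ 2 * q) HasProperDivisors (1 ∷ p ∷ p ^ 2 ∷ t ∷ p * q ∷ [])) (*-identityˡ q)
    (hasProperDivisors-*-prime q-prime (prime∤^ q-prime (prime∤prime q-prime p-prime (p≢q ∘′ sym)) 2)
      (m^n>0 p {{prime⇒nonZero p-prime}} 2) (hasProperDivisors-prime^2 p-prime))

doubling-recurrence : ∀ {X E P Q : ℕ → ℕ} →
  X 0 ≡ 1 + E 0 → (∀ c → X (suc c) ≡ 2 * X c + E (suc c)) →
  (∀ c → 2 * E c ≡ 2 ^ c * Q c) → P 0 ≡ 2 + Q 0 → (∀ c → P (suc c) ≡ P c + Q (suc c)) →
  ∀ c → 2 * X c ≡ 2 ^ c * P c
doubling-recurrence {X} {E} {P} {Q} X₀ X₁₊ 2E P₀ P₁₊ zero = begin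
  2 * X 0          ≡⟨ cong (2 *_) X₀ ⟩
  2 * (1 + E 0)    ≡⟨ *-distribˡ-+ 2 1 (E 0) ⟩
  2 + 2 * E 0      ≡⟨ cong (2 +_) (trans (2E 0) (*-identityˡ (Q 0))) ⟩
  2 + Q 0          ≡⟨ P₀ ⟨
  P 0              ≡⟨ *-identityˡ (P 0) ⟨
  1 * P 0 ∎
  where open ≡-Reasoning
doubling-recurrence {X} {E} {P} {Q} X₀ X₁₊ 2E P₀ P₁₊ (suc c) = begin
  2 * X (suc c)                                ≡⟨ cong (2 *_) (X₁₊ c) ⟩
  2 * (2 * X c + E (suc c))                    ≡⟨ *-distribˡ-+ 2 (2 * X c) (E (suc c)) ⟩
  2 * (2 * X c) + 2 * E (suc c)                ≡⟨ cong₂ _+_ (cong (2 *_) 2X) (2E (suc c)) ⟩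
  2 * (2 ^ c * P c) + 2 ^ suc c * Q (suc c)    ≡⟨ cong (_+ 2 ^ suc c * Q (suc c)) (*-assoc 2 (2 ^ c) (P c)) ⟨
  2 ^ suc c * P c + 2 ^ suc c * Q (suc c)      ≡⟨ *-distribˡ-+ (2 ^ suc c) (P c) (Q (suc c)) ⟨
  2 ^ suc c * (P c + Q (suc c))                ≡⟨ cong (2 ^ suc c *_) (P₁₊ c) ⟨
  2 ^ suc c * P (suc c) ∎
  where
  open ≡-Reasoning
  2X : 2 * X c ≡ 2 ^ c * P c
  2X = doubling-recurrence {X} {E} X₀ X₁₊ 2E P₀ P₁₊ c

-- The factor 2 keeps P integral for x = q² and x = q²r.
ClosedForm : ℕ → (ℕ → ℕ) → Set
ClosedForm x P = ∀ c → 2 * a (x * 2 ^ c) ≡ 2 ^ c * P c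

sumAt : List (ℕ → ℕ) → ℕ → ℕ
sumAt Ps c = sum (map (λ P → P c) Ps)

closedForm-sum : ∀ {ds Ps} → Pointwise ClosedForm ds Ps → ∀ c → 2 * sum (map (λ d → a (d * 2 ^ c)) ds) ≡ 2 ^ c * sumAt Ps c
closedForm-sum []                c = sym (*-zeroʳ (2 ^ c))
closedForm-sum {d ∷ ds} {P ∷ Ps} (d-cf ∷ ds-cf) c = begin
  2 * (a (d * 2 ^ c) + sum (map (λ d → a (d * 2 ^ c)) ds))        ≡⟨ *-distribˡ-+ 2 (a (d * 2 ^ c)) _ ⟩
  2 * a (d * 2 ^ c) + 2 * sum (map (λ d → a (d * 2 ^ c)) ds)      ≡⟨ cong₂ _+_ (d-cf c) (closedForm-sum ds-cf c) ⟩
  2 ^ c * P c + 2 ^ c * sumAt Ps c                                ≡⟨ *-distribˡ-+ (2 ^ c) (P c) (sumAt Ps c) ⟨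
  2 ^ c * sumAt (P ∷ Ps) c ∎
  where open ≡-Reasoning

closedForm : ∀ {x ds Ps} {P : ℕ → ℕ} → 0 < x → ¬ 2 ∣ x → x HasProperDivisors ds → Pointwise ClosedForm ds Ps →
  P 0 ≡ 2 + sumAt Ps 0 → (∀ c → P (suc c) ≡ P c + sumAt Ps (suc c)) → ClosedForm x P
closedForm {x} {ds} x>0 2∤x ds-pd ds-cf =
  doubling-recurrence {λ c → a (x * 2 ^ c)} {λ c → properDivisorSum (λ d → a (d * 2 ^ c)) x}
    a-x*1 (λ c → a-*-prime^suc prime[2] 2∤x x>0 c)
    (λ c → trans (cong (2 *_) (sum-properDivisors ds-pd _)) (closedForm-sum ds-cf c))
  where
  a-x*1 : a (x * 1) ≡ 1 + properDivisorSum (λ d → a (d * 1)) x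
  a-x*1 = begin
    a (x * 1)                                  ≡⟨ cong a (*-identityʳ x) ⟩
    a x                                        ≡⟨ a-unfold x>0 ⟩
    1 + properDivisorSum a x                   ≡⟨ cong (1 +_) (properDivisorSum-cong (λ d → cong a (*-identityʳ d)) x) ⟨
    1 + properDivisorSum (λ d → a (d * 1)) x ∎
    where open ≡-Reasoning

module PolynomialSyntax where
  open +-*-Solver

  ∑ : ∀ {n} → List (Polynomial n) → Polynomial n
  ∑ = foldr _:+_ (con 0)

  [p] [pq] [p²] [pqr] [p²q] : ∀ {n} → Polynomial n → Polynomial n
  [p]   c = con 2 :* (c :+ con 2)
  [pq]  c = con 2 :* (c :^ 2 :+ con 6 :* c :+ con 6)
  [p²]  c = c :^ 2 :+ con 7 :* c :+ con 8
  [pqr] c = con 2 :* (c :^ 3 :+ con 12 :* c :^ 2 :+ con 36 :* c :+ con 26)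
  [p²q] c = c :^ 3 :+ con 13 :* c :^ 2 :+ con 42 :* c :+ con 32

open PolynomialSyntax using (∑; [p]; [pq]; [p²]; [pqr]; [p²q])
open +-*-Solver using (solve; _:=_; _:+_; con)

closedForm-1 : ClosedForm 1 (λ _ → 2)
closedForm-1 = closedForm (s≤s z≤n) (prime∤1 prime[2]) hasProperDivisors-1 [] refl (λ _ → refl)

closedForm-prime : ∀ {p} → Prime p → p ≢ 2 → ClosedForm p (λ c → 2 * (c + 2))
closedForm-prime p-prime p≢2 = closedForm (prime>0 p-prime) (2∤odd-prime p-prime p≢2) (hasProperDivisors-prime p-prime)
  (closedForm-1 ∷ []) refl
  (solve 1 (λ c → [p] (con 1 :+ c) := [p] c :+ ∑ (con 2 ∷ [])) refl)

closedForm-prime*prime : ∀ {p q} → Prime p → Prime q → p ≢ 2 → q ≢ 2 → p ≢ q →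
  ClosedForm (p * q) (λ c → 2 * (c ^ 2 + 6 * c + 6))
closedForm-prime*prime p-prime q-prime p≢2 q≢2 p≢q =
  closedForm (*-mono-≤ (prime>0 p-prime) (prime>0 q-prime)) (prime∤* prime[2] (2∤odd-prime p-prime p≢2) (2∤odd-prime q-prime q≢2))
    (hasProperDivisors-prime*prime p-prime q-prime p≢q)
    (closedForm-1 ∷ closedForm-prime p-prime p≢2 ∷ closedForm-prime q-prime q≢2 ∷ []) refl
    (solve 1 (λ c → [pq] (con 1 :+ c) := [pq] c :+ ∑ (con 2 ∷ [p] (con 1 :+ c) ∷ [p] (con 1 :+ c) ∷ [])) refl)

closedForm-prime^2 : ∀ {p} → Prime p → p ≢ 2 → ClosedForm (p ^ 2) (λ c → c ^ 2 + 7 * c + 8)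
closedForm-prime^2 {p} p-prime p≢2 =
  closedForm (m^n>0 p {{prime⇒nonZero p-prime}} 2) (prime∤^ prime[2] (2∤odd-prime p-prime p≢2) 2)
    (hasProperDivisors-prime^2 p-prime)
    (closedForm-1 ∷ closedForm-prime p-prime p≢2 ∷ []) refl
    (solve 1 (λ c → [p²] (con 1 :+ c) := [p²] c :+ ∑ (con 2 ∷ [p] (con 1 :+ c) ∷ [])) refl)

closedForm-prime*prime*prime : ∀ {p q r} → Prime p → Prime q → Prime r →
  p ≢ 2 → q ≢ 2 → r ≢ 2 → p ≢ q → p ≢ r → q ≢ r →
  ClosedForm (p * q * r) (λ c → 2 * (c ^ 3 + 12 * c ^ 2 + 36 * c + 26))
closedForm-prime*prime*prime p-prime q-prime r-prime p≢2 q≢2 r≢2 p≢q p≢r q≢r =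
  closedForm (*-mono-≤ (*-mono-≤ (prime>0 p-prime) (prime>0 q-prime)) (prime>0 r-prime))
    (prime∤* prime[2] (prime∤* prime[2] (2∤odd-prime p-prime p≢2) (2∤odd-prime q-prime q≢2)) (2∤odd-prime r-prime r≢2))
    (hasProperDivisors-prime*prime*prime p-prime q-prime r-prime p≢q p≢r q≢r)
    (closedForm-1 ∷ closedForm-prime p-prime p≢2 ∷ closedForm-prime q-prime q≢2
      ∷ closedForm-prime*prime p-prime q-prime p≢2 q≢2 p≢q ∷ closedForm-prime r-prime r≢2
      ∷ closedForm-prime*prime p-prime r-prime p≢2 r≢2 p≢r ∷ closedForm-prime*prime q-prime r-prime q≢2 r≢2 q≢r ∷ [])
    refl
    (solve 1 (λ c → [pqr] (con 1 :+ c) := [pqr] c :+ ∑ (con 2 ∷ [p] (con 1 :+ c) ∷ [p] (con 1 :+ c) ∷ [pq] (con 1 :+ c)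
                                                        ∷ [p] (con 1 :+ c) ∷ [pq] (con 1 :+ c) ∷ [pq] (con 1 :+ c) ∷ [])) refl)

closedForm-prime^2*prime : ∀ {p q} → Prime p → Prime q → p ≢ 2 → q ≢ 2 → p ≢ q →
  ClosedForm (p ^ 2 * q) (λ c → c ^ 3 + 13 * c ^ 2 + 42 * c + 32)
closedForm-prime^2*prime {p} p-prime q-prime p≢2 q≢2 p≢q =
  closedForm (*-mono-≤ (m^n>0 p {{prime⇒nonZero p-prime}} 2) (prime>0 q-prime))
    (prime∤* prime[2] (prime∤^ prime[2] (2∤odd-prime p-prime p≢2) 2) (2∤odd-prime q-prime q≢2))
    (hasProperDivisors-prime^2*prime p-prime q-prime p≢q)
    (closedForm-1 ∷ closedForm-prime p-prime p≢2 ∷ closedForm-prime^2 p-prime p≢2 ∷ closedForm-prime q-prime q≢2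
      ∷ closedForm-prime*prime p-prime q-prime p≢2 q≢2 p≢q ∷ [])
    refl
    (solve 1 (λ c → [p²q] (con 1 :+ c) := [p²q] c :+ ∑ (con 2 ∷ [p] (con 1 :+ c) ∷ [p²] (con 1 :+ c)
                                                        ∷ [p] (con 1 :+ c) ∷ [pq] (con 1 :+ c) ∷ [])) refl)

pristine-2^* : ∀ {x P} → ClosedForm x P → ∀ c → P c ≡ 2 * x → Pristine (2 ^ c * x)
pristine-2^* {x} {P} x-cf c P≡2x = *-cancelˡ-≡ _ _ 2 (begin
  2 * a (2 ^ c * x)   ≡⟨ cong (λ n → 2 * a n) (*-comm (2 ^ c) x) ⟩
  2 * a (x * 2 ^ c)   ≡⟨ x-cf c ⟩
  2 ^ c * P c         ≡⟨ cong (2 ^ c *_) P≡2x ⟩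
  2 ^ c * (2 * x)     ≡⟨ x∙yz≈y∙xz (2 ^ c) 2 x ⟩
  2 * (2 ^ c * x) ∎)
  where open ≡-Reasoning

theorem4 : (c q r s : ℕ) → Prime q → Prime r → Prime s
    → q ≢ 2 → r ≢ 2 → s ≢ 2 → q ≢ r → q ≢ s → r ≢ s
    → Pristine (2 ^ c)
      × (q ≡ c + 2 → Pristine (2 ^ c * q))
      × (q * r ≡ c ^ 2 + 6 * c + 6 → Pristine (2 ^ c * q * r))
      × (2 * q ^ 2 ≡ c ^ 2 + 7 * c + 8 → Pristine (2 ^ c * q ^ 2))
      × (q * r * s ≡ c ^ 3 + 12 * c ^ 2 + 36 * c + 26 → Pristine (2 ^ c * q * r * s))
      × (2 * (q ^ 2 * r) ≡ c ^ 3 + 13 * c ^ 2 + 42 * c + 32 → Pristine (2 ^ c * q ^ 2 * r))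
theorem4 c q r s q-prime r-prime s-prime q≢2 r≢2 s≢2 q≢r q≢s r≢s =
    subst Pristine (*-identityʳ (2 ^ c)) (pristine-2^* closedForm-1 c refl)
  , (λ h → pristine-2^* (closedForm-prime q-prime q≢2) c (cong (2 *_) (sym h)))
  , (λ h → subst Pristine (sym (*-assoc (2 ^ c) q r))
             (pristine-2^* (closedForm-prime*prime q-prime r-prime q≢2 r≢2 q≢r) c (cong (2 *_) (sym h))))
  , (λ h → pristine-2^* (closedForm-prime^2 q-prime q≢2) c (sym h))
  , (λ h → subst Pristine 2^c*[q*r*s]≡2^c*q*r*s
             (pristine-2^* (closedForm-prime*prime*prime q-prime r-prime s-prime q≢2 r≢2 s≢2 q≢r q≢s r≢s) c
               (cong (2 *_) (sym h))))
  , (λ h → subst Pristine (sym (*-assoc (2 ^ c) (q ^ 2) r))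
             (pristine-2^* (closedForm-prime^2*prime q-prime r-prime q≢2 r≢2 q≢r) c (sym h)))
  where
  2^c*[q*r*s]≡2^c*q*r*s : 2 ^ c * (q * r * s) ≡ 2 ^ c * q * r * s
  2^c*[q*r*s]≡2^c*q*r*s = trans (sym (*-assoc (2 ^ c) (q * r) s)) (cong (_* s) (sym (*-assoc (2 ^ c) q r)))
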